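{- For every integer $n\ge 0$, there is a bijection between the set of isomorphism classes of split graphs on $n$ vertices and the set of isomorphism classes of $XY$-graphs on $n$ vertices with no isolates in $Y$.
   Context: A finite graph is a split graph if its vertex set can be partitioned into a clique and a stable set. An $XY$-graph is a bipartite graph together with a specified ordered bipartition $X\cup Y$ of its vertex set (every edge joins $X$ to $Y$; $X$ is the distinguished part); isomorphisms of $XY$-graphs must map $X$ onto $X'$ and $Y$ onto $Y'$. A vertex of $Y$ is an isolate if it has no neighbor. -}

module Defs where

open import Level using (0ℓ)
open import Data.Nat using (ℕ)
open import Data.Fin using (Fin)
open import Data.Bool using (Bool; true; false)
open import Data.Product using (Σ; ∃; _×_; _,_; proj₁; proj₂)
open import Relation.Nullary using (¬_)
open import Relation.Binary.PropositionalEquality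
  using (_≡_; _≢_; refl; sym; trans; cong; cong₂)
open import Relation.Binary.Bundles using (Setoid)
open import Relation.Binary.Structures using (IsEquivalence)
open import Function.Bundles using (_↔_; Inverse)
open import Function.Properties.Inverse using (↔-refl; ↔-sym; ↔-trans)

record Graph (n : ℕ) : Set where
  field
    adj   : Fin n → Fin n → Bool
    symm  : ∀ u v → adj u v ≡ adj v u
    irrefl : ∀ v → adj v v ≡ false
open Graph public

IsSplit : ∀ {n} → Graph n → Set
IsSplit {n} G = Σ (Fin n → Bool) λ inC →
    (∀ u v → inC u ≡ true → inC v ≡ true → u ≢ v → adj G u v ≡ true)
  × (∀ u v → inC u ≡ false → inC v ≡ false → adj G u v ≡ false)

-- Split graphs on n vertices (the partition witness is part of the data,
-- but isomorphism ignores it).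
SplitGraph : ℕ → Set
SplitGraph n = Σ (Graph n) IsSplit

GraphIso : ∀ {n} → Graph n → Graph n → Set
GraphIso {n} G H = Σ (Fin n ↔ Fin n) λ σ →
  ∀ u v → adj G u v ≡ adj H (Inverse.to σ u) (Inverse.to σ v)

record XYGraph (n : ℕ) : Set where
  field
    graph : Graph n
    inX   : Fin n → Bool
    bip   : ∀ u v → adj graph u v ≡ true → inX u ≢ inX v
open XYGraph public

NoYIsolates : ∀ {n} → XYGraph n → Set
NoYIsolates {n} B = ∀ v → inX B v ≡ false → ∃ λ u → adj (graph B) u v ≡ true

XYGraphNoIsol : ℕ → Set
XYGraphNoIsol n = Σ (XYGraph n) NoYIsolates

XYIso : ∀ {n} → XYGraph n → XYGraph n → Set
XYIso {n} B C = Σ (Fin n ↔ Fin n) λ σ →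
    (∀ u v → adj (graph B) u v ≡ adj (graph C) (Inverse.to σ u) (Inverse.to σ v))
  × (∀ v → inX B v ≡ inX C (Inverse.to σ v))

private
  inv-pres : ∀ {n} {A : Set} (f g : Fin n → Fin n → A) (σ : Fin n ↔ Fin n) →
    (∀ u v → f u v ≡ g (Inverse.to σ u) (Inverse.to σ v)) →
    ∀ u v → g u v ≡ f (Inverse.from σ u) (Inverse.from σ v)
  inv-pres f g σ p u v = trans
    (sym (cong₂ g (Inverse.strictlyInverseˡ σ u) (Inverse.strictlyInverseˡ σ v)))
    (sym (p (Inverse.from σ u) (Inverse.from σ v)))

  inv-pres₁ : ∀ {n} {A : Set} (f g : Fin n → A) (σ : Fin n ↔ Fin n) →
    (∀ v → f v ≡ g (Inverse.to σ v)) →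
    ∀ v → g v ≡ f (Inverse.from σ v)
  inv-pres₁ f g σ p v = trans (sym (cong g (Inverse.strictlyInverseˡ σ v)))
                              (sym (p (Inverse.from σ v)))

splitSetoid : ℕ → Setoid 0ℓ 0ℓ
splitSetoid n = record
  { Carrier = SplitGraph n
  ; _≈_ = λ G H → GraphIso (proj₁ G) (proj₁ H)
  ; isEquivalence = record
    { refl = ↔-refl , λ u v → refl
    ; sym = λ { {G} {H} (σ , p) → ↔-sym σ , inv-pres (adj (proj₁ G)) (adj (proj₁ H)) σ p }
    ; trans = λ { {G} {H} {K} (σ , p) (τ , q) → ↔-trans σ τ ,
        λ u v → trans (p u v) (q (Inverse.to σ u) (Inverse.to σ v)) }
    }
  }

xySetoid : ℕ → Setoid 0ℓ 0ℓ
xySetoid n = record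
  { Carrier = XYGraphNoIsol n
  ; _≈_ = λ B C → XYIso (proj₁ B) (proj₁ C)
  ; isEquivalence = record
    { refl = ↔-refl , (λ u v → refl) , (λ v → refl)
    ; sym = λ { {B} {C} (σ , p , s) → ↔-sym σ ,
        inv-pres (adj (graph (proj₁ B))) (adj (graph (proj₁ C))) σ p ,
        inv-pres₁ (inX (proj₁ B)) (inX (proj₁ C)) σ s }
    ; trans = λ { (σ , p , s) (τ , q , t) → ↔-trans σ τ ,
        (λ u v → trans (p u v) (q (Inverse.to σ u) (Inverse.to σ v))) ,
        (λ v → trans (s v) (t (Inverse.to σ v))) }
    }
  }

-- A partition (K, S) of a split graph G into a clique K and a stable set S
-- is called maximal when K cannot be enlarged, i.e. every vertex of S has a
-- non-neighbour in K.  Its XY-graph has X = K, Y = S, and x ∈ X, y ∈ Y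
-- adjacent exactly when they are non-adjacent in G; maximality is precisely
-- the absence of isolates in Y.  Conversely every XY-graph B determines a
-- split graph (X a clique, Y stable, cross edges the non-edges of B).

module Submission where

open import Defs
open import Data.Nat using (ℕ)
open import Data.Bool using (Bool; true; false; not; _∧_; _∨_; _xor_)
import Data.Bool as Bool
open import Data.Bool.Properties using (xor-comm; xor-same; not-involutive; ¬-not)
open import Data.Fin using (Fin; _≟_)
open import Data.Fin.Properties using (any?)
import Data.Fin.Permutation as Permutation
import Data.Fin.Permutation.Components as PC
open import Data.Product using (Σ; ∃; _×_; _,_; proj₁; proj₂)
open import Data.Sum using (_⊎_; inj₁; inj₂)
open import Data.Empty using (⊥-elim)
open import Function using (_∘_)
open import Function.Bundles using (Bijection; Inverse; Injection; _↔_)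
open import Function.Properties.Inverse using (↔-refl; ↔⇒↣; Inverse⇒Bijection)
open import Relation.Nullary using (Dec; yes; no; does)
open import Relation.Nullary.Decidable using (_×-dec_; ¬?; dec-true; dec-false; decidable-stable)
open import Relation.Binary.PropositionalEquality
import Relation.Binary.Reasoning.Setoid as SetoidReasoning

open Inverse using (to; from; strictlyInverseˡ)

true≢false : true ≢ false
true≢false ()

xor-∧-distinct : ∀ a b c → (a xor b) ∧ c ≡ true → a ≢ b
xor-∧-distinct true  true  c () _
xor-∧-distinct false false c () _
xor-∧-distinct true  false c _  ()
xor-∧-distinct false true  c _  ()

splitAdj : (xu xv distinct edge : Bool) → Bool
splitAdj true  true  distinct _    = distinct
splitAdj false false _        _    = false
splitAdj true  false _        edge = not edge
splitAdj false true  _        edge = not edge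

splitAdj-comm : ∀ xu xv d e → splitAdj xu xv d e ≡ splitAdj xv xu d e
splitAdj-comm true  true  d e = refl
splitAdj-comm false false d e = refl
splitAdj-comm true  false d e = refl
splitAdj-comm false true  d e = refl

splitAdj-irrefl : ∀ x e → splitAdj x x false e ≡ false
splitAdj-irrefl true  e = refl
splitAdj-irrefl false e = refl

-- Complementing the cross pairs twice gives back the XY-edges (which all cross).
splitAdj-cross : ∀ xu xv d e → (e ≡ true → xu ≢ xv) →
                 (xu xor xv) ∧ not (splitAdj xu xv d e) ≡ e
splitAdj-cross true  true  d true  crosses = ⊥-elim (crosses refl refl)
splitAdj-cross true  true  d false crosses = refl
splitAdj-cross false false d true  crosses = ⊥-elim (crosses refl refl)
splitAdj-cross false false d false crosses = refl
splitAdj-cross true  false d e     crosses = not-involutive e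
splitAdj-cross false true  d e     crosses = not-involutive e

does-≟-cong : ∀ {n} {u v u′ v′ : Fin n} →
              (u ≡ v → u′ ≡ v′) → (u′ ≡ v′ → u ≡ v) →
              does (u ≟ v) ≡ does (u′ ≟ v′)
does-≟-cong {u = u} {v} {u′} {v′} there back with u ≟ v | u′ ≟ v′
... | yes _  | yes _  = refl
... | no _   | no _   = refl
... | yes eq | no ne  = ⊥-elim (ne (there eq))
... | no ne  | yes eq = ⊥-elim (ne (back eq))

module _ {n : ℕ} where

  IsClique : Graph n → (Fin n → Bool) → Set
  IsClique G K = ∀ u v → K u ≡ true → K v ≡ true → u ≢ v → adj G u v ≡ true

  IsStable : Graph n → (Fin n → Bool) → Set
  IsStable G K = ∀ u v → K u ≡ false → K v ≡ false → adj G u v ≡ false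

  -- `IsSplit G` is by definition `Σ _ (SplitPartition G)`.
  SplitPartition : Graph n → (Fin n → Bool) → Set
  SplitPartition G K = IsClique G K × IsStable G K

  CliqueMaximal : Graph n → (Fin n → Bool) → Set
  CliqueMaximal G K = ∀ v → K v ≡ false → ∃ λ u → K u ≡ true × adj G u v ≡ false

  record MaximalPartition (G : Graph n) (K : Fin n → Bool) : Set where
    constructor maximal-partition
    field
      splitPartition : SplitPartition G K
      cliqueMaximal  : CliqueMaximal G K
  open MaximalPartition

  partitionXY : Graph n → (Fin n → Bool) → XYGraph n
  partitionXY G K = record
    { graph = record
      { adj    = λ u v → (K u xor K v) ∧ not (adj G u v)
      ; symm   = λ u v → cong₂ _∧_ (xor-comm (K u) (K v)) (cong not (symm G u v))
      ; irrefl = λ v → cong (_∧ not (adj G v v)) (xor-same (K v))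
      }
    ; inX   = K
    ; bip   = λ u v → xor-∧-distinct (K u) (K v) _
    }

  partitionXY-noIsolates : ∀ {G K} → CliqueMaximal G K → NoYIsolates (partitionXY G K)
  partitionXY-noIsolates {G} {K} maximal v kv with maximal v kv
  ... | u , ku , nonadjacent = u , joined
    where
    joined : (K u xor K v) ∧ not (adj G u v) ≡ true
    joined rewrite ku | kv | nonadjacent = refl

  maximalXY : (G : Graph n) (K : Fin n → Bool) → MaximalPartition G K → XYGraphNoIsol n
  maximalXY G K m = partitionXY G K , partitionXY-noIsolates {G} {K} (cliqueMaximal m)

  partitionXY-iso : ∀ G H K L (σ : Fin n ↔ Fin n) →
                    (∀ u v → adj G u v ≡ adj H (to σ u) (to σ v)) →
                    (∀ u → K u ≡ L (to σ u)) →
                    XYIso (partitionXY G K) (partitionXY H L)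
  partitionXY-iso G H K L σ edges sides =
    σ , (λ u v → cong₂ _∧_ (cong₂ _xor_ (sides u) (sides v)) (cong not (edges u v))) , sides

  -- Adding a stable vertex s adjacent to the whole clique gives a maximal
  -- partition: every other stable vertex is a non-neighbour of s.
  insert-maximal : ∀ G {K} s → SplitPartition G K → K s ≡ false →
                   (∀ u → K u ≡ true → adj G u s ≡ true) →
                   MaximalPartition G (λ w → K w ∨ does (w ≟ s))
  insert-maximal G {K} s (clique , stable) ks s-dominates =
    maximal-partition (clique⁺ , stable⁺) maximal⁺
    where
    K⁺ : Fin n → Bool
    K⁺ w = K w ∨ does (w ≟ s)

    in-K⁺ : ∀ w → K⁺ w ≡ true → K w ≡ true ⊎ w ≡ s
    in-K⁺ w e  with K w | w ≟ s
    in-K⁺ w e  | true  | _       = inj₁ refl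
    in-K⁺ w e  | false | yes w≡s = inj₂ w≡s
    in-K⁺ w () | false | no _

    outside-K⁺ : ∀ w → K⁺ w ≡ false → K w ≡ false
    outside-K⁺ w e  with K w
    outside-K⁺ w () | true
    outside-K⁺ w e  | false = refl

    s∈K⁺ : K⁺ s ≡ true
    s∈K⁺ = trans (cong (_∨ does (s ≟ s)) ks) (dec-true (s ≟ s) refl)

    clique⁺ : IsClique G K⁺
    clique⁺ u v ku kv u≢v with in-K⁺ u ku | in-K⁺ v kv
    ... | inj₁ u∈K  | inj₁ v∈K  = clique u v u∈K v∈K u≢v
    ... | inj₁ u∈K  | inj₂ refl = s-dominates u u∈K
    ... | inj₂ refl | inj₁ v∈K  = trans (symm G s v) (s-dominates v v∈K)
    ... | inj₂ refl | inj₂ refl = ⊥-elim (u≢v refl)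

    stable⁺ : IsStable G K⁺
    stable⁺ u v ku kv = stable u v (outside-K⁺ u ku) (outside-K⁺ v kv)

    maximal⁺ : CliqueMaximal G K⁺
    maximal⁺ v kv = s , s∈K⁺ , stable s v ks (outside-K⁺ v kv)

  nonNeighbourIn? : ∀ (G : Graph n) (K : Fin n → Bool) v →
                    Dec (∃ λ u → K u ≡ true × adj G u v ≡ false)
  nonNeighbourIn? G K v = any? λ u → (K u Bool.≟ true) ×-dec (adj G u v Bool.≟ false)

  maximalise : ∀ G {K} → SplitPartition G K → Σ (Fin n → Bool) (MaximalPartition G)
  maximalise G {K} split
    with any? (λ s → (K s Bool.≟ false) ×-dec ¬? (nonNeighbourIn? G K s))
  ... | yes (s , ks , dominates) =
    _ , insert-maximal G s split ks (λ u ku → ¬-not (λ e → dominates (u , ku , e)))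
  ... | no none = K , maximal-partition split maximal
    where
    maximal : CliqueMaximal G K
    maximal v kv = decidable-stable (nonNeighbourIn? G K v) (λ ¬found → none (v , kv , ¬found))

  splitOf : XYGraph n → Graph n
  splitOf B = record
    { adj    = λ u v → splitAdj (inX B u) (inX B v) (not (does (u ≟ v))) (adj (graph B) u v)
    ; symm   = λ u v → trans (splitAdj-comm (inX B u) (inX B v) _ _)
                 (cong₂ (splitAdj (inX B v) (inX B u))
                        (cong not (does-≟-cong {u = u} {v} sym sym)) (symm (graph B) u v))
    ; irrefl = λ v → trans (cong (λ d → splitAdj (inX B v) (inX B v) (not d) _)
                                 (dec-true (v ≟ v) refl))
                           (splitAdj-irrefl (inX B v) _)
    }

  splitOf-maximal : ∀ B → NoYIsolates B → MaximalPartition (splitOf B) (inX B)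
  splitOf-maximal B noIsolates = maximal-partition (clique , stable) maximal
    where
    clique : IsClique (splitOf B) (inX B)
    clique u v xu xv u≢v rewrite xu | xv | dec-false (u ≟ v) u≢v = refl

    stable : IsStable (splitOf B) (inX B)
    stable u v xu xv rewrite xu | xv = refl

    maximal : CliqueMaximal (splitOf B) (inX B)
    maximal v yv with noIsolates v yv
    ... | u , edge = u , xu , nonadjacent
      where
      xu : inX B u ≡ true
      xu = ¬-not (λ e → bip B u v edge (trans e (sym yv)))

      nonadjacent : adj (splitOf B) u v ≡ false
      nonadjacent rewrite xu | yv | edge = refl

  splitOf-partitionXY : ∀ G {K} → SplitPartition G K →
                        ∀ u v → adj (splitOf (partitionXY G K)) u v ≡ adj G u v
  splitOf-partitionXY G {K} (clique , stable) u v with u ≟ v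
  ... | yes refl = trans (splitAdj-irrefl (K u) _) (sym (irrefl G u))
  ... | no u≢v with K u in ku | K v in kv
  ...   | true  | true  = sym (clique u v ku kv u≢v)
  ...   | false | false = sym (stable u v ku kv)
  ...   | true  | false = not-involutive (adj G u v)
  ...   | false | true  = not-involutive (adj G u v)

  partitionXY-splitOf : ∀ B → XYIso (partitionXY (splitOf B) (inX B)) B
  partitionXY-splitOf B =
    ↔-refl , (λ u v → splitAdj-cross (inX B u) (inX B v) _ _ (bip B u v)) , (λ v → refl)

  splitOf-cong : ∀ B C → XYIso B C → GraphIso (splitOf B) (splitOf C)
  splitOf-cong B C (σ , edges , sides) = σ , preserved
    where
    distinct-preserved : ∀ u v → not (does (u ≟ v)) ≡ not (does (to σ u ≟ to σ v))
    distinct-preserved u v = cong not (does-≟-cong (cong (to σ)) (Injection.injective (↔⇒↣ σ)))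

    preserved : ∀ u v → adj (splitOf B) u v ≡ adj (splitOf C) (to σ u) (to σ v)
    preserved u v =
      trans (cong₂ (λ a b → splitAdj a b (not (does (u ≟ v))) (adj (graph B) u v)) (sides u) (sides v))
            (cong₂ (splitAdj (inX C (to σ u)) (inX C (to σ v))) (distinct-preserved u v) (edges u v))

  data TransposeCase (x y : Fin n) : Fin n → Fin n → Set where
    at-x  : TransposeCase x y x y
    at-y  : TransposeCase x y y x
    fixed : ∀ {w} → w ≢ x → w ≢ y → TransposeCase x y w w

  transpose-case : ∀ x y w → TransposeCase x y w (PC.transpose x y w)
  transpose-case x y w with w ≟ x
  ... | yes refl = at-x
  ... | no w≢x with w ≟ y
  ...   | yes refl = at-y
  ...   | no w≢y   = fixed w≢x w≢y

  Twins : Graph n → Fin n → Fin n → Set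
  Twins G x y = ∀ w → w ≢ x → w ≢ y → adj G x w ≡ adj G y w

  transpose-automorphism : ∀ G x y → Twins G x y →
                           ∀ u v → adj G u v ≡ adj G (PC.transpose x y u) (PC.transpose x y v)
  transpose-automorphism G x y twins u v with PC.transpose x y u | transpose-case x y u
  ... | .y | at-x = row-x v
    where
    row-x : ∀ v → adj G x v ≡ adj G y (PC.transpose x y v)
    row-x v with PC.transpose x y v | transpose-case x y v
    ... | .y | at-x            = trans (irrefl G x) (sym (irrefl G y))
    ... | .x | at-y            = symm G x y
    ... | .v | fixed v≢x v≢y   = twins v v≢x v≢y
  ... | .x | at-y = row-y v
    where
    row-y : ∀ v → adj G y v ≡ adj G x (PC.transpose x y v)
    row-y v with PC.transpose x y v | transpose-case x y v
    ... | .y | at-x            = symm G y x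
    ... | .x | at-y            = trans (irrefl G y) (sym (irrefl G x))
    ... | .v | fixed v≢x v≢y   = sym (twins v v≢x v≢y)
  ... | .u | fixed u≢x u≢y = other-row v
    where
    other-row : ∀ v → adj G u v ≡ adj G u (PC.transpose x y v)
    other-row v with PC.transpose x y v | transpose-case x y v
    ... | .y | at-x      = trans (symm G u x) (trans (twins u u≢x u≢y) (symm G y u))
    ... | .x | at-y      = trans (symm G u y) (trans (sym (twins u u≢x u≢y)) (symm G x u))
    ... | .v | fixed _ _ = refl

  -- Split partitions that differ by exchanging x ∈ K ∖ L with y ∈ L ∖ K
  -- make x and y twins, so their XY-graphs are isomorphic via the transposition.
  swap-iso : ∀ G {K L} → SplitPartition G K → SplitPartition G L →
             ∀ x y → K x ≡ true → L x ≡ false → K y ≡ false → L y ≡ true →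
             (∀ w → w ≢ x → w ≢ y → K w ≡ L w) →
             XYIso (partitionXY G K) (partitionXY G L)
  swap-iso G {K} {L} (cliqueK , stableK) (cliqueL , stableL) x y kx lx ky ly agree =
    partitionXY-iso G G K L (Permutation.transpose x y) (transpose-automorphism G x y twins) sides
    where
    twins : Twins G x y
    twins w w≢x w≢y with K w in kw
    ... | true  = trans (cliqueK x w kx kw (≢-sym w≢x))
                        (sym (cliqueL y w ly (trans (sym (agree w w≢x w≢y)) kw) (≢-sym w≢y)))
    ... | false = trans (stableL x w lx (trans (sym (agree w w≢x w≢y)) kw))
                        (sym (stableK y w ky kw))

    sides : ∀ w → K w ≡ L (PC.transpose x y w)
    sides w with PC.transpose x y w | transpose-case x y w
    ... | .y | at-x            = trans kx (sym ly)
    ... | .x | at-y            = trans ky (sym lx)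
    ... | .w | fixed w≢x w≢y   = agree w w≢x w≢y

  -- If maximal partitions K, L disagree at x ∈ K ∖ L, then a non-neighbour y
  -- of x in L lies in L ∖ K, and K, L agree everywhere outside {x, y}.
  exchange-partner : ∀ {G K L} → MaximalPartition G K → MaximalPartition G L →
                     ∀ x → K x ≡ true → L x ≡ false →
                     ∃ λ y → K y ≡ false × L y ≡ true × (∀ w → w ≢ x → w ≢ y → K w ≡ L w)
  exchange-partner {G} {K} {L} (maximal-partition (cliqueK , stableK) _)
                   (maximal-partition (cliqueL , stableL) maximalL) x kx lx
    with maximalL x lx
  ... | y , ly , yx-nonadjacent = y , ky , ly , agree
    where
    y≢x : y ≢ x
    y≢x y≡x = true≢false (trans (sym ly) (trans (cong L y≡x) lx))

    ky : K y ≡ false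
    ky = ¬-not λ ky′ → true≢false (trans (sym (cliqueK y x ky′ kx y≢x)) yx-nonadjacent)

    agree : ∀ w → w ≢ x → w ≢ y → K w ≡ L w
    agree w w≢x w≢y with K w in kw | L w in lw
    ... | true  | true  = refl
    ... | false | false = refl
    ... | true  | false = ⊥-elim (true≢false (trans (sym (cliqueK x w kx kw (≢-sym w≢x)))
                                                     (stableL x w lx lw)))
    ... | false | true  = ⊥-elim (true≢false (trans (sym (cliqueL y w ly lw (≢-sym w≢y)))
                                                     (stableK y w ky kw)))

  maximal-partitions-iso : ∀ {G K L} → MaximalPartition G K → MaximalPartition G L →
                           XYIso (partitionXY G K) (partitionXY G L)
  maximal-partitions-iso {G} {K} {L} mK mL with any? (λ v → ¬? (K v Bool.≟ L v))
  ... | no agreeEverywhere =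
    partitionXY-iso G G K L ↔-refl (λ _ _ → refl)
      (λ v → decidable-stable (K v Bool.≟ L v) (λ kv≢lv → agreeEverywhere (v , kv≢lv)))
  ... | yes (x , kx≢lx) with K x in kx | ¬-not (≢-sym kx≢lx)
  ...   | true  | lx =
    let y , ky , ly , agree = exchange-partner mK mL x kx lx
    in swap-iso G (splitPartition mK) (splitPartition mL) x y kx lx ky ly agree
  ...   | false | lx =
    let y , ly , ky , agree = exchange-partner mL mK x lx kx
    in swap-iso G (splitPartition mK) (splitPartition mL) y x ky ly kx lx
                (λ w w≢y w≢x → sym (agree w w≢x w≢y))

  pullback-maximal : ∀ {G H L} (σ : Fin n ↔ Fin n) →
                     (∀ u v → adj G u v ≡ adj H (to σ u) (to σ v)) →
                     MaximalPartition H L → MaximalPartition G (L ∘ to σ)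
  pullback-maximal {G} {H} {L} σ edges (maximal-partition (clique , stable) maximal) =
    maximal-partition (clique′ , stable′) maximal′
    where
    clique′ : IsClique G (L ∘ to σ)
    clique′ u v lu lv u≢v =
      trans (edges u v) (clique (to σ u) (to σ v) lu lv (u≢v ∘ Injection.injective (↔⇒↣ σ)))

    stable′ : IsStable G (L ∘ to σ)
    stable′ u v lu lv = trans (edges u v) (stable (to σ u) (to σ v) lu lv)

    maximal′ : CliqueMaximal G (L ∘ to σ)
    maximal′ v lv with maximal (to σ v) lv
    ... | u , lu , nonadjacent =
      from σ u ,
      trans (cong L (strictlyInverseˡ σ u)) lu ,
      trans (edges (from σ u) v)
            (trans (cong (λ z → adj H z (to σ v)) (strictlyInverseˡ σ u)) nonadjacent)

  maximalXY-cong : ∀ {G H K L} → GraphIso G H →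
                   (mK : MaximalPartition G K) (mL : MaximalPartition H L) →
                   XYIso (partitionXY G K) (partitionXY H L)
  maximalXY-cong {G} {H} {K} {L} (σ , edges) mK mL = begin
    maximalXY G K mK            ≈⟨ maximal-partitions-iso mK mL′ ⟩
    maximalXY G (L ∘ to σ) mL′  ≈⟨ partitionXY-iso G H (L ∘ to σ) L σ edges (λ _ → refl) ⟩
    maximalXY H L mL            ∎
    where
    open SetoidReasoning (xySetoid n)
    mL′ : MaximalPartition G (L ∘ to σ)
    mL′ = pullback-maximal σ edges mL

  toXY : SplitGraph n → XYGraphNoIsol n
  toXY (G , _ , split) = maximalXY G (proj₁ maximal) (proj₂ maximal)
    where maximal = maximalise G split

  fromXY : XYGraphNoIsol n → SplitGraph n
  fromXY (B , noIsolates) = splitOf B , inX B , splitPartition (splitOf-maximal B noIsolates)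

  toXY-cong : ∀ G H → GraphIso (proj₁ G) (proj₁ H) → XYIso (proj₁ (toXY G)) (proj₁ (toXY H))
  toXY-cong (G , _ , sK) (H , _ , sL) iso =
    maximalXY-cong iso (proj₂ (maximalise G sK)) (proj₂ (maximalise H sL))

  toXY-fromXY : ∀ B → XYIso (proj₁ (toXY (fromXY B))) (proj₁ B)
  toXY-fromXY (B , noIsolates) = begin
    maximalXY (splitOf B) (proj₁ maximal) (proj₂ maximal)
      ≈⟨ maximal-partitions-iso (proj₂ maximal) mX ⟩
    maximalXY (splitOf B) (inX B) mX
      ≈⟨ partitionXY-splitOf B ⟩
    B , noIsolates
      ∎
    where
    open SetoidReasoning (xySetoid n)
    mX : MaximalPartition (splitOf B) (inX B)
    mX = splitOf-maximal B noIsolates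
    maximal : Σ (Fin n → Bool) (MaximalPartition (splitOf B))
    maximal = maximalise (splitOf B) (splitPartition mX)

  fromXY-toXY : ∀ G → GraphIso (proj₁ (fromXY (toXY G))) (proj₁ G)
  fromXY-toXY (G , _ , split) =
    ↔-refl , splitOf-partitionXY G (splitPartition (proj₂ (maximalise G split)))

  splitXYInverse : Inverse (splitSetoid n) (xySetoid n)
  splitXYInverse = record
    { to        = toXY
    ; from      = fromXY
    ; to-cong   = λ {G} {H} → toXY-cong G H
    ; from-cong = λ {B} {C} → splitOf-cong (proj₁ B) (proj₁ C)
    ; inverse   = (λ {B} {G} → toXY-inverse B G) , (λ {G} {B} → fromXY-inverse G B)
    }
    where
    toXY-inverse : ∀ B G → GraphIso (proj₁ G) (proj₁ (fromXY B)) →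
                   XYIso (proj₁ (toXY G)) (proj₁ B)
    toXY-inverse B G G≅fromB = begin
      toXY G           ≈⟨ toXY-cong G (fromXY B) G≅fromB ⟩
      toXY (fromXY B)  ≈⟨ toXY-fromXY B ⟩
      B                ∎
      where open SetoidReasoning (xySetoid n)

    fromXY-inverse : ∀ G B → XYIso (proj₁ B) (proj₁ (toXY G)) →
                     GraphIso (proj₁ (fromXY B)) (proj₁ G)
    fromXY-inverse G B B≅toG = begin
      fromXY B           ≈⟨ splitOf-cong (proj₁ B) (proj₁ (toXY G)) B≅toG ⟩
      fromXY (toXY G)    ≈⟨ fromXY-toXY G ⟩
      G                  ∎
      where open SetoidReasoning (splitSetoid n)

theorem3p3 : (n : ℕ) → Bijection (splitSetoid n) (xySetoid n)
theorem3p3 n = Inverse⇒Bijection splitXYInverse
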